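{- Let $G$ be a connected graph containing neither a bull nor a claw as an induced subgraph. If $G$ contains an odd antihole as an induced subgraph, then $\alpha(G)=2$.
   Context: A bull is the graph with vertices $v_1,\ldots,v_5$ and edges $v_1v_2,v_2v_3,v_3v_4,v_4v_5,v_2v_4$; a claw is $K_{1,3}$. An odd antihole is a graph whose complement is an induced cycle of odd length at least $5$. $\alpha(G)$ is the independence number of $G$. -}

module Defs where

open import Data.Nat using (ℕ; zero; suc; _+_; _≤_; _≥_; _*_)
open import Data.Fin using (Fin; zero; suc; toℕ)
open import Data.Fin.Patterns
open import Data.Nat.DivMod using (_%_)
open import Data.Product using (Σ; ∃; ∃-syntax; _×_; _,_)
open import Data.Sum using (_⊎_)
open import Data.Empty using (⊥)
open import Data.List using (List; []; _∷_)
open import Relation.Nullary using (¬_; Dec)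
open import Relation.Binary.PropositionalEquality using (_≡_)
open import Function.Definitions using (Injective)
open import Function.Bundles using (_⇔_)

record Graph (n : ℕ) : Set₁ where
  field
    Adj     : Fin n → Fin n → Set
    adj?    : ∀ u v → Dec (Adj u v)
    sym     : ∀ {u v} → Adj u v → Adj v u
    irrefl  : ∀ {u} → ¬ Adj u u
open Graph public

record InducedSub {k n : ℕ} (H : Graph k) (G : Graph n) : Set where
  field
    emb      : Fin k → Fin n
    emb-inj  : Injective _≡_ _≡_ emb
    emb-adj  : ∀ u v → (Adj H u v ⇔ Adj G (emb u) (emb v))

_≤ᵢ_ : {k n : ℕ} → Graph k → Graph n → Set
H ≤ᵢ G = InducedSub H G

data Walk {n : ℕ} (G : Graph n) : Fin n → Fin n → Set where
  here : ∀ {u} → Walk G u u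
  step : ∀ {u w v} → Adj G u w → Walk G w v → Walk G u v

Connected : {n : ℕ} → Graph n → Set
Connected {n} G = (u v : Fin n) → Walk G u v

data BullAdj : Fin 5 → Fin 5 → Set where
  e01 : BullAdj 0F 1F
  e10 : BullAdj 1F 0F
  e12 : BullAdj 1F 2F
  e21 : BullAdj 2F 1F
  e23 : BullAdj 2F 3F
  e32 : BullAdj 3F 2F
  e34 : BullAdj 3F 4F
  e43 : BullAdj 4F 3F
  e13 : BullAdj 1F 3F
  e31 : BullAdj 3F 1F

data ClawAdj : Fin 4 → Fin 4 → Set where
  c0l : ∀ {i} → ¬ (i ≡ 0F) → ClawAdj 0F i
  cl0 : ∀ {i} → ¬ (i ≡ 0F) → ClawAdj i 0F

CycAdj : (m : ℕ) → Fin m → Fin m → Set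
CycAdj m i j = (toℕ j ≡ (suc (toℕ i)) % suc (m Data.Nat.∸ 1))
             ⊎ (toℕ i ≡ (suc (toℕ j)) % suc (m Data.Nat.∸ 1))

AntiAdj : (m : ℕ) → Fin m → Fin m → Set
AntiAdj m i j = ¬ (i ≡ j) × ¬ CycAdj m i j

IsBull : Graph 5 → Set
IsBull H = ∀ u v → (Adj H u v ⇔ BullAdj u v)

IsClaw : Graph 4 → Set
IsClaw H = ∀ u v → (Adj H u v ⇔ ClawAdj u v)

IsAntihole : (m : ℕ) → Graph m → Set
IsAntihole m H = ∀ u v → (Adj H u v ⇔ AntiAdj m u v)

HasInducedBull : {n : ℕ} → Graph n → Set₁
HasInducedBull G = Σ (Graph 5) λ H → IsBull H × (H ≤ᵢ G)

HasInducedClaw : {n : ℕ} → Graph n → Set₁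
HasInducedClaw G = Σ (Graph 4) λ H → IsClaw H × (H ≤ᵢ G)

Odd : ℕ → Set
Odd m = ∃[ k ] m ≡ suc (2 * k)

HasInducedOddAntihole : {n : ℕ} → Graph n → Set₁
HasInducedOddAntihole G =
  Σ ℕ λ m → Odd m × m ≥ 5 × Σ (Graph m) λ H → IsAntihole m H × (H ≤ᵢ G)

IndependentSet : {n : ℕ} → Graph n → ℕ → Set
IndependentSet {n} G k =
  Σ (Fin k → Fin n) λ f → Injective _≡_ _≡_ f × (∀ i j → ¬ Adj G (f i) (f j))

IndependenceNumber : {n : ℕ} → Graph n → ℕ → Set
IndependenceNumber G a =
  IndependentSet G a × (∀ k → IndependentSet G k → k ≤ a)

module Submission where

open import Defs
open import Data.Nat using (ℕ; zero; suc; _+_; _*_; _≤_; _<_; _∸_; z≤n; s≤s; z<s; NonZero; _<?_)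
open import Data.Nat.DivMod
open import Data.Nat.Divisibility using (∣-refl)
open import Data.Nat.Properties
  using ( _≟_; +-comm; +-suc; +-identityʳ; <-trans; n<1+n; ≮⇒≥; <⇒≢; m<n+m; m∸n+n≡m
        ; +-cancelʳ-≡; +-cancelʳ-<; +-mono-< )
open import Data.Nat.Tactic.RingSolver using (solve-∀)
open import Data.Fin using (Fin; toℕ)
open import Data.Fin.Patterns
import Data.Fin.Properties as Fin
open import Data.Product using (∃; ∃-syntax; _×_; _,_; proj₁; proj₂)
open import Data.Sum as Sum using (_⊎_; inj₁; inj₂)
open import Data.Empty using (⊥; ⊥-elim)
open import Function.Base using (_∘_; id; const)
open import Function.Bundles using (_⇔_; mk⇔; Equivalence)
open import Function.Definitions using (Injective)
open import Relation.Nullary using (¬_; Dec; yes; no)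
open import Relation.Nullary.Decidable using (decidable-stable; _⊎-dec_)
open import Relation.Binary.PropositionalEquality as ≡
  using (_≡_; _≢_; ≢-sym; refl; cong; subst; trans)

-- Index the odd antihole cyclically as a₀ … a₂ₖ, so that its non-adjacent pairs are exactly the
-- consecutive ones, and call a vertex covering if it is adjacent to aᵢ or aᵢ₊₁ for every i.
-- Claw- and bull-freeness force a vertex off the antihole with a neighbour on it to be covering;
-- as 2k + 1 is odd, a covering vertex sees two consecutive aᵢ, aᵢ₊₁, so by claw-freeness each
-- of its neighbours has a neighbour on the antihole. By connectivity every vertex lies on the
-- antihole or is covering. An independent triple of such vertices is then excluded according to
-- how many of them lie on the antihole; for three covering vertices, the pattern of which of
-- them see aᵢ shifts by a transposition at every step around the cycle, which its odd length
-- forbids.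

module _ {n : ℕ} (G : Graph n) where

  Independent : Fin n → Fin n → Set
  Independent x y = ¬ Adj G x y × x ≢ y

  ≁-sym : ∀ {x y} → ¬ Adj G x y → ¬ Adj G y x
  ≁-sym x≁y = x≁y ∘ sym G

  Independent-sym : ∀ {x y} → Independent x y → Independent y x
  Independent-sym (x≁y , x≢y) = ≁-sym x≁y , x≢y ∘ ≡.sym

  adj⇒≢ : ∀ {x y} → Adj G x y → x ≢ y
  adj⇒≢ x~y refl = irrefl G x~y

  inducedBy : ∀ {k} → (Fin k → Fin n) → Graph k
  inducedBy f = record
    { Adj = λ u v → Adj G (f u) (f v)
    ; adj? = λ u v → adj? G (f u) (f v)
    ; sym = sym G
    ; irrefl = irrefl G
    }

  inducedBy-≤ᵢ : ∀ {k} {f : Fin k → Fin n} → Injective _≡_ _≡_ f → inducedBy f ≤ᵢ G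
  inducedBy-≤ᵢ {f = f} f-inj = record
    { emb = f ; emb-inj = f-inj ; emb-adj = λ _ _ → mk⇔ id id }

  private
    both⇔ : ∀ {A B : Set} → A → B → A ⇔ B
    both⇔ a b = mk⇔ (const b) (const a)

    neither⇔ : ∀ {A B : Set} → ¬ A → ¬ B → A ⇔ B
    neither⇔ ¬a ¬b = mk⇔ (⊥-elim ∘ ¬a) (⊥-elim ∘ ¬b)

  induced-claw : ∀ {c x y z} → Adj G c x → Adj G c y → Adj G c z →
                 Independent x y → Independent x z → Independent y z →
                 HasInducedClaw G
  induced-claw {c} {x} {y} {z} c~x c~y c~z (x≁y , x≢y) (x≁z , x≢z) (y≁z , y≢z) =
    inducedBy f , isClaw , inducedBy-≤ᵢ f-inj
    where
    f : Fin 4 → Fin n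
    f 0F = c
    f 1F = x
    f 2F = y
    f 3F = z

    ¬loop : ¬ ClawAdj 0F 0F
    ¬loop (c0l 0≢0) = 0≢0 refl
    ¬loop (cl0 0≢0) = 0≢0 refl

    isClaw : IsClaw (inducedBy f)
    isClaw 0F 0F = neither⇔ (irrefl G) ¬loop
    isClaw 0F 1F = both⇔ c~x (c0l λ ())
    isClaw 0F 2F = both⇔ c~y (c0l λ ())
    isClaw 0F 3F = both⇔ c~z (c0l λ ())
    isClaw 1F 0F = both⇔ (sym G c~x) (cl0 λ ())
    isClaw 2F 0F = both⇔ (sym G c~y) (cl0 λ ())
    isClaw 3F 0F = both⇔ (sym G c~z) (cl0 λ ())
    isClaw 1F 1F = neither⇔ (irrefl G) λ ()
    isClaw 2F 2F = neither⇔ (irrefl G) λ ()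
    isClaw 3F 3F = neither⇔ (irrefl G) λ ()
    isClaw 1F 2F = neither⇔ x≁y λ ()
    isClaw 1F 3F = neither⇔ x≁z λ ()
    isClaw 2F 3F = neither⇔ y≁z λ ()
    isClaw 2F 1F = neither⇔ (≁-sym x≁y) λ ()
    isClaw 3F 1F = neither⇔ (≁-sym x≁z) λ ()
    isClaw 3F 2F = neither⇔ (≁-sym y≁z) λ ()

    f-inj : Injective _≡_ _≡_ f
    f-inj {0F} {0F} _ = refl
    f-inj {1F} {1F} _ = refl
    f-inj {2F} {2F} _ = refl
    f-inj {3F} {3F} _ = refl
    f-inj {0F} {1F} e = ⊥-elim (adj⇒≢ c~x e)
    f-inj {0F} {2F} e = ⊥-elim (adj⇒≢ c~y e)
    f-inj {0F} {3F} e = ⊥-elim (adj⇒≢ c~z e)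
    f-inj {1F} {0F} e = ⊥-elim (adj⇒≢ c~x (≡.sym e))
    f-inj {2F} {0F} e = ⊥-elim (adj⇒≢ c~y (≡.sym e))
    f-inj {3F} {0F} e = ⊥-elim (adj⇒≢ c~z (≡.sym e))
    f-inj {1F} {2F} e = ⊥-elim (x≢y e)
    f-inj {1F} {3F} e = ⊥-elim (x≢z e)
    f-inj {2F} {3F} e = ⊥-elim (y≢z e)
    f-inj {2F} {1F} e = ⊥-elim (x≢y (≡.sym e))
    f-inj {3F} {1F} e = ⊥-elim (x≢z (≡.sym e))
    f-inj {3F} {2F} e = ⊥-elim (y≢z (≡.sym e))

  induced-bull : ∀ {v₀ v₁ v₂ v₃ v₄} →
    Adj G v₀ v₁ → Adj G v₁ v₂ → Adj G v₂ v₃ → Adj G v₃ v₄ → Adj G v₁ v₃ →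
    ¬ Adj G v₀ v₂ → ¬ Adj G v₀ v₃ → ¬ Adj G v₀ v₄ → ¬ Adj G v₁ v₄ → ¬ Adj G v₂ v₄ →
    HasInducedBull G
  induced-bull {v₀} {v₁} {v₂} {v₃} {v₄} v₀₁ v₁₂ v₂₃ v₃₄ v₁₃ ¬v₀₂ ¬v₀₃ ¬v₀₄ ¬v₁₄ ¬v₂₄ =
    inducedBy f , isBull , inducedBy-≤ᵢ f-inj
    where
    f : Fin 5 → Fin n
    f 0F = v₀
    f 1F = v₁
    f 2F = v₂
    f 3F = v₃
    f 4F = v₄

    isBull : IsBull (inducedBy f)
    isBull 0F 0F = neither⇔ (irrefl G) λ ()
    isBull 1F 1F = neither⇔ (irrefl G) λ ()
    isBull 2F 2F = neither⇔ (irrefl G) λ ()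
    isBull 3F 3F = neither⇔ (irrefl G) λ ()
    isBull 4F 4F = neither⇔ (irrefl G) λ ()
    isBull 0F 1F = both⇔ v₀₁ e01
    isBull 1F 0F = both⇔ (sym G v₀₁) e10
    isBull 1F 2F = both⇔ v₁₂ e12
    isBull 2F 1F = both⇔ (sym G v₁₂) e21
    isBull 2F 3F = both⇔ v₂₃ e23
    isBull 3F 2F = both⇔ (sym G v₂₃) e32
    isBull 3F 4F = both⇔ v₃₄ e34
    isBull 4F 3F = both⇔ (sym G v₃₄) e43
    isBull 1F 3F = both⇔ v₁₃ e13
    isBull 3F 1F = both⇔ (sym G v₁₃) e31
    isBull 0F 2F = neither⇔ ¬v₀₂ λ ()
    isBull 2F 0F = neither⇔ (≁-sym ¬v₀₂) λ ()
    isBull 0F 3F = neither⇔ ¬v₀₃ λ ()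
    isBull 3F 0F = neither⇔ (≁-sym ¬v₀₃) λ ()
    isBull 0F 4F = neither⇔ ¬v₀₄ λ ()
    isBull 4F 0F = neither⇔ (≁-sym ¬v₀₄) λ ()
    isBull 1F 4F = neither⇔ ¬v₁₄ λ ()
    isBull 4F 1F = neither⇔ (≁-sym ¬v₁₄) λ ()
    isBull 2F 4F = neither⇔ ¬v₂₄ λ ()
    isBull 4F 2F = neither⇔ (≁-sym ¬v₂₄) λ ()

    separated : ∀ {w p q} → Adj G w p → ¬ Adj G w q → p ≢ q
    separated w~p w≁q refl = w≁q w~p

    v₀≢v₂ : v₀ ≢ v₂
    v₀≢v₂ = ≢-sym (separated (sym G v₂₃) (≁-sym ¬v₀₃))
    v₀≢v₃ : v₀ ≢ v₃
    v₀≢v₃ = ≢-sym (separated v₂₃ (≁-sym ¬v₀₂))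
    v₀≢v₄ : v₀ ≢ v₄
    v₀≢v₄ = separated (sym G v₀₁) ¬v₁₄
    v₁≢v₄ : v₁ ≢ v₄
    v₁≢v₄ = separated v₀₁ ¬v₀₄
    v₂≢v₄ : v₂ ≢ v₄
    v₂≢v₄ = separated v₁₂ ¬v₁₄

    f-inj : Injective _≡_ _≡_ f
    f-inj {0F} {0F} _ = refl
    f-inj {1F} {1F} _ = refl
    f-inj {2F} {2F} _ = refl
    f-inj {3F} {3F} _ = refl
    f-inj {4F} {4F} _ = refl
    f-inj {0F} {1F} e = ⊥-elim (adj⇒≢ v₀₁ e)
    f-inj {1F} {0F} e = ⊥-elim (adj⇒≢ v₀₁ (≡.sym e))
    f-inj {1F} {2F} e = ⊥-elim (adj⇒≢ v₁₂ e)
    f-inj {2F} {1F} e = ⊥-elim (adj⇒≢ v₁₂ (≡.sym e))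
    f-inj {2F} {3F} e = ⊥-elim (adj⇒≢ v₂₃ e)
    f-inj {3F} {2F} e = ⊥-elim (adj⇒≢ v₂₃ (≡.sym e))
    f-inj {3F} {4F} e = ⊥-elim (adj⇒≢ v₃₄ e)
    f-inj {4F} {3F} e = ⊥-elim (adj⇒≢ v₃₄ (≡.sym e))
    f-inj {1F} {3F} e = ⊥-elim (adj⇒≢ v₁₃ e)
    f-inj {3F} {1F} e = ⊥-elim (adj⇒≢ v₁₃ (≡.sym e))
    f-inj {0F} {2F} e = ⊥-elim (v₀≢v₂ e)
    f-inj {2F} {0F} e = ⊥-elim (v₀≢v₂ (≡.sym e))
    f-inj {0F} {3F} e = ⊥-elim (v₀≢v₃ e)
    f-inj {3F} {0F} e = ⊥-elim (v₀≢v₃ (≡.sym e))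
    f-inj {0F} {4F} e = ⊥-elim (v₀≢v₄ e)
    f-inj {4F} {0F} e = ⊥-elim (v₀≢v₄ (≡.sym e))
    f-inj {1F} {4F} e = ⊥-elim (v₁≢v₄ e)
    f-inj {4F} {1F} e = ⊥-elim (v₁≢v₄ (≡.sym e))
    f-inj {2F} {4F} e = ⊥-elim (v₂≢v₄ e)
    f-inj {4F} {2F} e = ⊥-elim (v₂≢v₄ (≡.sym e))

  independenceNumber-2 : ∀ {x y} → Independent x y →
    (∀ {x y z} → Independent x y → Independent x z → Independent y z → ⊥) →
    IndependenceNumber G 2
  independenceNumber-2 {x} {y} (x≁y , x≢y) no-triple = (f , f-inj , f-independent) , bound
    where
    f : Fin 2 → Fin n
    f 0F = x
    f 1F = y

    f-inj : Injective _≡_ _≡_ f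
    f-inj {0F} {0F} _ = refl
    f-inj {1F} {1F} _ = refl
    f-inj {0F} {1F} e = ⊥-elim (x≢y e)
    f-inj {1F} {0F} e = ⊥-elim (x≢y (≡.sym e))

    f-independent : ∀ i j → ¬ Adj G (f i) (f j)
    f-independent 0F 0F = irrefl G
    f-independent 1F 1F = irrefl G
    f-independent 0F 1F = x≁y
    f-independent 1F 0F = ≁-sym x≁y

    bound : ∀ j → IndependentSet G j → j ≤ 2
    bound 0 _ = z≤n
    bound 1 _ = s≤s z≤n
    bound 2 _ = s≤s (s≤s z≤n)
    bound (suc (suc (suc _))) (g , g-inj , g-independent) =
      ⊥-elim (no-triple (pair 0F 1F λ ()) (pair 0F 2F λ ()) (pair 1F 2F λ ()))
      where
      pair : ∀ u v → u ≢ v → Independent (g u) (g v)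
      pair u v u≢v = g-independent u v , u≢v ∘ g-inj

module _ (m : ℕ) .{{_ : NonZero m}} where

  toℕ-mod : ∀ i → toℕ (i mod m) ≡ i % m
  toℕ-mod i = Fin.toℕ-fromℕ< (m%n<n i m)

  mod-≡⇒%-≡ : ∀ {i j} → i mod m ≡ j mod m → i % m ≡ j % m
  mod-≡⇒%-≡ {i} {j} e = trans (≡.sym (toℕ-mod i)) (trans (cong toℕ e) (toℕ-mod j))

  %-≡⇒mod-≡ : ∀ {i j} → i % m ≡ j % m → i mod m ≡ j mod m
  %-≡⇒mod-≡ {i} {j} e = Fin.toℕ-injective (trans (toℕ-mod i) (trans e (≡.sym (toℕ-mod j))))

  [1+i%m]%m≡[1+i]%m : ∀ i → suc (i % m) % m ≡ suc i % m
  [1+i%m]%m≡[1+i]%m i = begin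
    (1 + i % m) % m           ≡⟨ %-distribˡ-+ 1 (i % m) m ⟩
    (1 % m + i % m % m) % m   ≡⟨ cong (λ r → (1 % m + r) % m) (m%n%n≡m%n i m) ⟩
    (1 % m + i % m) % m       ≡⟨ %-distribˡ-+ 1 i m ⟨
    (1 + i) % m               ∎
    where open ≡.≡-Reasoning

  %-suc-cong : ∀ {i j} → i % m ≡ j % m → suc i % m ≡ suc j % m
  %-suc-cong {i} {j} e =
    trans (≡.sym ([1+i%m]%m≡[1+i]%m i)) (trans (cong (λ r → suc r % m) e) ([1+i%m]%m≡[1+i]%m j))

  [d+i]%m≢i%m : ∀ {d} i → 0 < d → d < m → (d + i) % m ≢ i % m
  [d+i]%m≢i%m {d} i 0<d d<m eq = impossible (d + r <? m)
    where
    open ≡.≡-Reasoning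
    r : ℕ
    r = i % m

    [d+r]%m≡r : (d + r) % m ≡ r
    [d+r]%m≡r = begin
      (d + r) % m      ≡⟨ cong (λ d′ → (d′ + r) % m) (m<n⇒m%n≡m d<m) ⟨
      (d % m + r) % m  ≡⟨ %-distribˡ-+ d i m ⟨
      (d + i) % m      ≡⟨ eq ⟩
      r                ∎

    impossible : Dec (d + r < m) → ⊥
    impossible (yes d+r<m) =
      <⇒≢ (m<n+m r 0<d) (≡.sym (trans (≡.sym (m<n⇒m%n≡m d+r<m)) [d+r]%m≡r))
    impossible (no d+r≮m) = <⇒≢ d<m (+-cancelʳ-≡ r d m d+r≡m+r)
      where
      m≤d+r : m ≤ d + r
      m≤d+r = ≮⇒≥ d+r≮m
      s : ℕ
      s = d + r ∸ m
      s+m≡d+r : s + m ≡ d + r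
      s+m≡d+r = m∸n+n≡m m≤d+r
      s<m : s < m
      s<m = +-cancelʳ-< m s m (subst (_< m + m) (≡.sym s+m≡d+r) (+-mono-< d<m (m%n<n i m)))
      s≡r : s ≡ r
      s≡r = begin
        s            ≡⟨ m<n⇒m%n≡m s<m ⟨
        s % m        ≡⟨ m≤n⇒[n∸m]%m≡n%m m≤d+r ⟩
        (d + r) % m  ≡⟨ [d+r]%m≡r ⟩
        r            ∎
      d+r≡m+r : d + r ≡ m + r
      d+r≡m+r = begin
        d + r  ≡⟨ s+m≡d+r ⟨
        s + m  ≡⟨ cong (_+ m) s≡r ⟩
        r + m  ≡⟨ +-comm r m ⟩
        m + r  ∎

+-left-comm : ∀ x y z → x + (y + z) ≡ y + (x + z)
+-left-comm = solve-∀

[i+jK]+j≡i+j[1+K] : ∀ i j K → i + j * K + j ≡ i + j * suc K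
[i+jK]+j≡i+j[1+K] = solve-∀

-- The vertices a₀ … a₂ₖ of an odd antihole of G, indexed by ℕ and read modulo 2k + 1.
record CyclicOddAntihole {n : ℕ} (G : Graph n) : Set where
  field
    k                 : ℕ
    a                 : ℕ → Fin n
    a-period          : ∀ t → a (suc (2 * k + t)) ≡ a t
    a-suc-cong        : ∀ {i j} → a i ≡ a j → a (suc i) ≡ a (suc j)
    a-representative  : ∀ i → ∃ λ (j : Fin (suc (2 * k))) → a i ≡ a (toℕ j)
    ¬adj-suc          : ∀ i → ¬ Adj G (a i) (a (suc i))
    adj-2+            : ∀ i → Adj G (a i) (a (2 + i))
    adj-3+            : ∀ i → Adj G (a i) (a (3 + i))
    independent⇒consecutive : ∀ {i j} → Independent G (a i) (a j) →
                              a j ≡ a (suc i) ⊎ a i ≡ a (suc j)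

module _ {n : ℕ} {G : Graph n} {k : ℕ} {H : Graph (suc (2 * k))}
         (5≤m : 5 ≤ suc (2 * k)) (H-antihole : IsAntihole (suc (2 * k)) H) (H≤G : H ≤ᵢ G)
         where

  private
    open InducedSub H≤G
    open Equivalence

    m : ℕ
    m = suc (2 * k)

    a : ℕ → Fin n
    a i = emb (i mod m)

    a-cong : ∀ {i j} → i % m ≡ j % m → a i ≡ a j
    a-cong {i} {j} = cong emb ∘ %-≡⇒mod-≡ m {i} {j}

    a-injective : ∀ {i j} → a i ≡ a j → i % m ≡ j % m
    a-injective {i} {j} = mod-≡⇒%-≡ m {i} {j} ∘ emb-inj

    Consecutive : ℕ → ℕ → Set
    Consecutive i j = j % m ≡ suc i % m ⊎ i % m ≡ suc j % m

    successor⇔ : ∀ i j → (toℕ (j mod m) ≡ suc (toℕ (i mod m)) % m) ⇔ (j % m ≡ suc i % m)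
    successor⇔ i j rewrite toℕ-mod m i | toℕ-mod m j =
      mk⇔ (λ e → trans e [1+i]) (λ e → trans e (≡.sym [1+i]))
      where
      [1+i] : suc (i % m) % m ≡ suc i % m
      [1+i] = [1+i%m]%m≡[1+i]%m m i

    cycAdj⇔consecutive : ∀ i j → CycAdj m (i mod m) (j mod m) ⇔ Consecutive i j
    cycAdj⇔consecutive i j = mk⇔ (Sum.map (to (successor⇔ i j)) (to (successor⇔ j i)))
                                 (Sum.map (from (successor⇔ i j)) (from (successor⇔ j i)))

    adj⇒¬consecutive : ∀ {i j} → Adj G (a i) (a j) → ¬ Consecutive i j
    adj⇒¬consecutive {i} {j} i~j =
      proj₂ (to (H-antihole _ _) (from (emb-adj _ _) i~j)) ∘ from (cycAdj⇔consecutive i j)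

    ¬consecutive⇒adj : ∀ {i j} → i % m ≢ j % m → ¬ Consecutive i j → Adj G (a i) (a j)
    ¬consecutive⇒adj {i} {j} i≢j ¬c = to (emb-adj _ _) (from (H-antihole _ _)
      (i≢j ∘ mod-≡⇒%-≡ m {i} {j} , ¬c ∘ to (cycAdj⇔consecutive i j)))

    adj-2+e : ∀ e i → 3 + e < m → Adj G (a i) (a (2 + e + i))
    adj-2+e e i 3+e<m = ¬consecutive⇒adj {i} {2 + e + i} (≢-sym ([d+i]%m≢i%m m i z<s 2+e<m)) λ
      { (inj₁ eq) → [d+i]%m≢i%m m (suc i) z<s 1+e<m
                      (trans (cong (λ x → suc x % m) (+-suc e i)) eq)
      ; (inj₂ eq) → [d+i]%m≢i%m m i z<s 3+e<m (≡.sym eq)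
      }
      where
      2+e<m : 2 + e < m
      2+e<m = <-trans (n<1+n _) 3+e<m
      1+e<m : 1 + e < m
      1+e<m = <-trans (n<1+n _) 2+e<m

    independent⇒consecutive : ∀ {i j} → Independent G (a i) (a j) → a j ≡ a (suc i) ⊎ a i ≡ a (suc j)
    independent⇒consecutive {i} {j} (i≁j , i≢j) =
      Sum.map (a-cong {j} {suc i}) (a-cong {i} {suc j})
        (decidable-stable ((j % m ≟ suc i % m) ⊎-dec (i % m ≟ suc j % m))
                          (i≁j ∘ ¬consecutive⇒adj {i} {j} (i≢j ∘ a-cong {i} {j})))

  cyclicOddAntihole : CyclicOddAntihole G
  cyclicOddAntihole = record
    { k                       = k
    ; a                       = a
    ; a-period                = λ t → a-cong {suc (2 * k + t)} {t} (%-remove-+ˡ {m} t ∣-refl)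
    ; a-suc-cong              = λ {i} {j} → a-cong {suc i} {suc j} ∘ %-suc-cong m {i} {j} ∘ a-injective {i} {j}
    ; a-representative        = λ i → i mod m , a-cong {i} {toℕ (i mod m)}
        (≡.sym (trans (cong (_% m) (toℕ-mod m i)) (m%n%n≡m%n i m)))
    ; ¬adj-suc                = λ i i~i+1 → adj⇒¬consecutive {i} {suc i} i~i+1 (inj₁ refl)
    ; adj-2+                  = λ i → adj-2+e 0 i (<-trans (n<1+n 3) 5≤m)
    ; adj-3+                  = λ i → adj-2+e 1 i 5≤m
    ; independent⇒consecutive = independent⇒consecutive
    }

-- Unlike 2 * d, twice (suc d) reduces to suc (suc (twice d)), as stepping two at a time needs.
twice : ℕ → ℕ
twice zero    = zero
twice (suc j) = suc (suc (twice j))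

twice≡2* : ∀ j → twice j ≡ 2 * j
twice≡2* zero    = refl
twice≡2* (suc j) = trans (cong (suc ∘ suc) (twice≡2* j)) (cong suc (≡.sym (+-suc j (j + 0))))

module ClawBullFree {n : ℕ} {G : Graph n}
                    (no-bull : ¬ HasInducedBull G) (no-claw : ¬ HasInducedClaw G)
                    (A : CyclicOddAntihole G) where

  open CyclicOddAntihole A

  ¬common-neighbour : ∀ {x y z c} →
    Independent G x y → Independent G x z → Independent G y z →
    Adj G x c → Adj G y c → Adj G z c → ⊥
  ¬common-neighbour x⊥y x⊥z y⊥z x~c y~c z~c =
    no-claw (induced-claw G (sym G x~c) (sym G y~c) (sym G z~c) x⊥y x⊥z y⊥z)

  period : ∀ t → a (suc (twice k + t)) ≡ a t
  period t = trans (cong (λ s → a (suc (s + t))) (twice≡2* k)) (a-period t)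

  period-multiple : ∀ j t → a (t + j * suc (2 * k)) ≡ a t
  period-multiple zero    t = cong a (+-identityʳ t)
  period-multiple (suc j) t = begin
    a (t + (m + j * m))  ≡⟨ cong a (+-left-comm t m (j * m)) ⟩
    a (m + (t + j * m))  ≡⟨ a-period (t + j * m) ⟩
    a (t + j * m)        ≡⟨ period-multiple j t ⟩
    a t                  ∎
    where
    open ≡.≡-Reasoning
    m : ℕ
    m = suc (2 * k)

  a-suc-≢ : ∀ i → a i ≢ a (suc i)
  a-suc-≢ i aᵢ≡aᵢ₊₁ =
    ¬adj-suc (suc i) (subst (λ v → Adj G v (a (2 + i))) aᵢ≡aᵢ₊₁ (adj-2+ i))

  consecutive-independent : ∀ i → Independent G (a i) (a (suc i))
  consecutive-independent i = ¬adj-suc i , a-suc-≢ i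

  some-index? : ∀ {P : Fin n → Set} → (∀ w → Dec (P w)) → Dec (∃[ i ] P (a i))
  some-index? {P} P? with Fin.any? (λ (j : Fin (suc (2 * k))) → P? (a (toℕ j)))
  ... | yes (j , p) = yes (toℕ j , p)
  ... | no none     = no λ (i , p) →
    let (j , aᵢ≡aⱼ) = a-representative i in none (j , subst P aᵢ≡aⱼ p)

  OnAntihole : Fin n → Set
  OnAntihole w = ∃[ i ] w ≡ a i

  OffAntihole : Fin n → Set
  OffAntihole w = ∀ i → w ≢ a i

  Covering : Fin n → Set
  Covering w = ∀ i → Adj G w (a i) ⊎ Adj G w (a (suc i))

  Tame : Fin n → Set
  Tame w = OnAntihole w ⊎ Covering w

  covering-next : ∀ {w i} → Covering w → ¬ Adj G w (a i) → Adj G w (a (suc i))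
  covering-next {i = i} cov w≁aᵢ = Sum.[ ⊥-elim ∘ w≁aᵢ , id ] (cov i)

  covering-prev : ∀ {w i} → Covering w → ¬ Adj G w (a (suc i)) → Adj G w (a i)
  covering-prev {i = i} cov w≁aᵢ₊₁ = Sum.[ id , ⊥-elim ∘ w≁aᵢ₊₁ ] (cov i)

  ¬adj₁₂⇒¬adj₀ : ∀ {v j} → OffAntihole v →
                 ¬ Adj G v (a (1 + j)) → ¬ Adj G v (a (2 + j)) → ¬ Adj G v (a j)
  ¬adj₁₂⇒¬adj₀ {v} {j} off v≁a₁ v≁a₂ v~a₀ with adj? G v (a (3 + j))
  ... | no v≁a₃ =
    ¬common-neighbour (v≁a₂ , off (2 + j)) (v≁a₃ , off (3 + j)) (consecutive-independent (2 + j))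
                      v~a₀ (sym G (adj-2+ j)) (sym G (adj-3+ j))
  ... | yes v~a₃ = no-bull (induced-bull G
    (sym G (adj-2+ j)) (sym G v~a₀) v~a₃ (sym G (adj-2+ (suc j))) (adj-3+ j)
    (≁-sym G v≁a₂) (¬adj-suc (2 + j)) (≁-sym G (¬adj-suc (suc j))) (¬adj-suc j) v≁a₁)

  ¬adj-pair⇒¬adj-before : ∀ {v} → OffAntihole v → ∀ d j →
                          ¬ Adj G v (a (d + j)) → ¬ Adj G v (a (suc (d + j))) → ¬ Adj G v (a j)
  ¬adj-pair⇒¬adj-before off zero    j v≁aⱼ _   = v≁aⱼ
  ¬adj-pair⇒¬adj-before off (suc d) j v≁a₁ v≁a₂ =
    ¬adj-pair⇒¬adj-before off d j (¬adj₁₂⇒¬adj₀ off v≁a₁ v≁a₂) v≁a₁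

  covering-of-neighbour : ∀ {w j} → OffAntihole w → Adj G w (a j) → Covering w
  covering-of-neighbour {w} {j} off w~aⱼ i with adj? G w (a i) | adj? G w (a (suc i))
  ... | yes w~aᵢ | _          = inj₁ w~aᵢ
  ... | no _     | yes w~aᵢ₊₁ = inj₂ w~aᵢ₊₁
  ... | no w≁aᵢ  | no w≁aᵢ₊₁  =
    ⊥-elim (¬adj-pair⇒¬adj-before off d j w≁a[d+j] w≁a[d+j+1] w~aⱼ)
    where
    -- d + j ≡ i modulo 2k + 1.
    d : ℕ
    d = i + j * (2 * k)
    d+j≡i+jm : d + j ≡ i + j * suc (2 * k)
    d+j≡i+jm = [i+jK]+j≡i+j[1+K] i j (2 * k)
    w≁a[d+j] : ¬ Adj G w (a (d + j))
    w≁a[d+j] = w≁aᵢ ∘ subst (Adj G w) (trans (cong a d+j≡i+jm) (period-multiple j i))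
    w≁a[d+j+1] : ¬ Adj G w (a (suc (d + j)))
    w≁a[d+j+1] =
      w≁aᵢ₊₁ ∘ subst (Adj G w) (trans (cong (a ∘ suc) d+j≡i+jm) (period-multiple j (suc i)))

  covering⇒consecutive-neighbours : ∀ {w} → Covering w →
                                    ∃[ i ] Adj G w (a i) × Adj G w (a (suc i))
  covering⇒consecutive-neighbours {w} cov = Sum.[ from-a₀ , from-a₁ ] (cov 0)
    where
    Pair : Set
    Pair = ∃[ i ] Adj G w (a i) × Adj G w (a (suc i))

    walk : ∀ d t → Adj G w (a t) → Pair ⊎ Adj G w (a (twice d + t))
    walk zero    t w~aₜ = inj₂ w~aₜ
    walk (suc d) t w~aₜ with walk d t w~aₜ
    ... | inj₁ pair = inj₁ pair
    ... | inj₂ w~aₛ with adj? G w (a (suc (twice d + t)))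
    ...   | yes w~aₛ₊₁ = inj₁ (_ , w~aₛ , w~aₛ₊₁)
    ...   | no w≁aₛ₊₁  = inj₂ (covering-next cov w≁aₛ₊₁)

    -- Stepping by two from a₀ (resp. a₁) wraps around the odd cycle to a₂ₖ (resp. a₂ₖ₊₁ = a₀).
    from-a₀ : Adj G w (a 0) → Pair
    from-a₀ w~a₀ = Sum.[ id , (λ w~a₂ₖ → _ , w~a₂ₖ , subst (Adj G w) (≡.sym (period 0)) w~a₀) ]
                         (walk k 0 w~a₀)

    from-a₁ : Adj G w (a 1) → Pair
    from-a₁ w~a₁ = Sum.[ id , (λ w~a₂ₖ₊₁ → 0 , subst (Adj G w) a₂ₖ₊₁≡a₀ w~a₂ₖ₊₁ , w~a₁) ]
                         (walk k 1 w~a₁)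
      where
      a₂ₖ₊₁≡a₀ : a (twice k + 1) ≡ a 0
      a₂ₖ₊₁≡a₀ = trans (cong a (+-suc (twice k) 0)) (period 0)

  tame-closed : ∀ {u w} → Tame u → Adj G u w → Tame w
  tame-closed {u} {w} tame-u u~w with some-index? (w Fin.≟_) | some-index? (adj? G w)
  ... | yes on | _              = inj₁ on
  ... | no off | yes (j , w~aⱼ) = inj₂ (covering-of-neighbour (λ i w≡aᵢ → off (i , w≡aᵢ)) w~aⱼ)
  ... | no off | no isolated    = Sum.[ on-case , covering-case ] tame-u
    where
    apart : ∀ i → Independent G (a i) w
    apart i = (λ aᵢ~w → isolated (i , sym G aᵢ~w)) , λ aᵢ≡w → off (i , ≡.sym aᵢ≡w)

    on-case : OnAntihole u → Tame w
    on-case (i , u≡aᵢ) = ⊥-elim (proj₁ (apart i) (subst (λ v → Adj G v w) u≡aᵢ u~w))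

    covering-case : Covering u → Tame w
    covering-case cov with covering⇒consecutive-neighbours cov
    ... | i , u~aᵢ , u~aᵢ₊₁ =
      ⊥-elim (¬common-neighbour (consecutive-independent i) (apart i) (apart (suc i))
                                (sym G u~aᵢ) (sym G u~aᵢ₊₁) (sym G u~w))

  walk⇒tame : ∀ {u w} → Walk G u w → Tame u → Tame w
  walk⇒tame here           tame-u = tame-u
  walk⇒tame (step u~v v⇝w) tame-u = walk⇒tame v⇝w (tame-closed tame-u u~v)

  connected⇒tame : Connected G → ∀ w → Tame w
  connected⇒tame connected w = walk⇒tame (connected (a 0) w) (inj₁ (0 , refl))

  ¬independent-successor-triple : ∀ {p q r} → a q ≡ a (suc p) → Independent G (a p) (a q) →
                                 Independent G (a p) (a r) → Independent G (a q) (a r) → ⊥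
  ¬independent-successor-triple {p} {q} {r} q≡p+1 (_ , p≢q) p⊥r q⊥r@(_ , q≢r)
    with independent⇒consecutive p⊥r | independent⇒consecutive q⊥r
  ... | inj₁ r≡p+1 | _          = q≢r (trans q≡p+1 (≡.sym r≡p+1))
  ... | inj₂ p≡r+1 | inj₂ q≡r+1 = p≢q (trans p≡r+1 (≡.sym q≡r+1))
  ... | inj₂ p≡r+1 | inj₁ r≡q+1 = adj⇒≢ G (adj-3+ p) (begin
    a p        ≡⟨ p≡r+1 ⟩
    a (suc r)  ≡⟨ a-suc-cong r≡q+1 ⟩
    a (2 + q)  ≡⟨ a-suc-cong (a-suc-cong q≡p+1) ⟩
    a (3 + p)  ∎)
    where open ≡.≡-Reasoning

  ¬independent-triple₃ : ∀ {p q r} → Independent G (a p) (a q) → Independent G (a p) (a r) →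
                         Independent G (a q) (a r) → ⊥
  ¬independent-triple₃ p⊥q p⊥r q⊥r with independent⇒consecutive p⊥q
  ... | inj₁ q≡p+1 = ¬independent-successor-triple q≡p+1 p⊥q p⊥r q⊥r
  ... | inj₂ p≡q+1 = ¬independent-successor-triple p≡q+1 (Independent-sym G p⊥q) q⊥r p⊥r

  ¬independent-triple₂ : ∀ {p q z} → Covering z → Independent G (a p) (a q) →
                         Independent G (a p) z → Independent G (a q) z → ⊥
  ¬independent-triple₂ {p} {q} {z} cov p⊥q (p≁z , _) (q≁z , _)
    with independent⇒consecutive p⊥q
  ... | inj₁ q≡p+1 = Sum.[ p≁z ∘ sym G , q≁z ∘ sym G ∘ subst (Adj G z) (≡.sym q≡p+1) ] (cov p)
  ... | inj₂ p≡q+1 = Sum.[ q≁z ∘ sym G , p≁z ∘ sym G ∘ subst (Adj G z) (≡.sym p≡q+1) ] (cov q)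

  ¬independent-triple₁-seeing-a₂ : ∀ {p y z} → Covering y → Covering z →
    Independent G (a p) y → Independent G (a p) z → Independent G y z → Adj G y (a (2 + p)) → ⊥
  ¬independent-triple₁-seeing-a₂ {p} {y} {z} cov-y cov-z p⊥y@(p≁y , _) p⊥z@(p≁z , _) y⊥z@(y≁z , _) y~a₂ =
    no-bull (induced-bull G y~a₁ (sym G z~a₁) z~a₃ (sym G (adj-3+ p)) (adj-2+ (suc p))
                            y≁z y≁a₃ (≁-sym G p≁y) (≁-sym G (¬adj-suc p)) (≁-sym G p≁z))
    where
    y~a₁ : Adj G y (a (suc p))
    y~a₁ = covering-next cov-y (≁-sym G p≁y)
    z~a₁ : Adj G z (a (suc p))
    z~a₁ = covering-next cov-z (≁-sym G p≁z)
    z~a₃ : Adj G z (a (3 + p))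
    z~a₃ = covering-next cov-z (¬common-neighbour p⊥y p⊥z y⊥z (adj-2+ p) y~a₂)
    y≁a₃ : ¬ Adj G y (a (3 + p))
    y≁a₃ = λ y~a₃ → ¬common-neighbour p⊥y p⊥z y⊥z (adj-3+ p) y~a₃ z~a₃

  ¬independent-triple₁ : ∀ {p y z} → Covering y → Covering z → Independent G (a p) y →
                         Independent G (a p) z → Independent G y z → ⊥
  ¬independent-triple₁ {p} {y} {z} cov-y cov-z p⊥y p⊥z y⊥z
    with adj? G y (a (2 + p)) | adj? G z (a (2 + p))
  ... | yes y~a₂ | _        = ¬independent-triple₁-seeing-a₂ cov-y cov-z p⊥y p⊥z y⊥z y~a₂
  ... | no _     | yes z~a₂ =
    ¬independent-triple₁-seeing-a₂ cov-z cov-y p⊥z p⊥y (Independent-sym G y⊥z) z~a₂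
  ... | no y≁a₂  | no z≁a₂  =
    ¬common-neighbour p⊥y p⊥z y⊥z (adj-3+ p) (covering-next cov-y y≁a₂) (covering-next cov-z z≁a₂)

  record CoveringTriple (x y z : Fin n) : Set where
    field
      x-covering : Covering x
      y-covering : Covering y
      z-covering : Covering z
      x⊥y        : Independent G x y
      x⊥z        : Independent G x z
      y⊥z        : Independent G y z

  swap : ∀ {x y z} → CoveringTriple x y z → CoveringTriple x z y
  swap T = record
    { x-covering = x-covering ; y-covering = z-covering ; z-covering = y-covering
    ; x⊥y = x⊥z ; x⊥z = x⊥y ; y⊥z = Independent-sym G y⊥z }
    where open CoveringTriple T

  Phase : Fin n → Fin n → Fin n → ℕ → Set
  Phase x y z j = Adj G x (a j) × Adj G y (a j) × ¬ Adj G z (a j) ×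
                  Adj G x (a (suc j)) × Adj G z (a (suc j)) × ¬ Adj G y (a (suc j))

  module _ {x y z} (T : CoveringTriple x y z) where
    open CoveringTriple T

    phase-start : ∀ {i} → Adj G x (a i) → Adj G x (a (suc i)) → Adj G y (a i) → Phase x y z i
    phase-start {i} x~a₀ x~a₁ y~a₀ = x~a₀ , y~a₀ , z≁a₀ , x~a₁ , z~a₁ , y≁a₁
      where
      z≁a₀ : ¬ Adj G z (a i)
      z≁a₀ = ¬common-neighbour x⊥y x⊥z y⊥z x~a₀ y~a₀
      z~a₁ : Adj G z (a (suc i))
      z~a₁ = covering-next z-covering z≁a₀
      y≁a₁ : ¬ Adj G y (a (suc i))
      y≁a₁ = λ y~a₁ → ¬common-neighbour x⊥y x⊥z y⊥z x~a₁ y~a₁ z~a₁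

    phase-shift : ∀ {j} → Phase x y z j → Phase x z y (suc j)
    phase-shift {j} (x~a₀ , y~a₀ , z≁a₀ , x~a₁ , z~a₁ , y≁a₁) =
      x~a₁ , z~a₁ , y≁a₁ , x~a₂ , y~a₂ , z≁a₂
      where
      y~a₂ : Adj G y (a (2 + j))
      y~a₂ = covering-next y-covering y≁a₁

      z≁a₂ : ¬ Adj G z (a (2 + j))
      z≁a₂ z~a₂ with adj? G x (a (2 + j))
      ... | yes x~a₂ = ¬common-neighbour x⊥y x⊥z y⊥z x~a₂ y~a₂ z~a₂
      ... | no x≁a₂  = no-bull (induced-bull G
        x~a₀ (sym G y~a₀) y~a₂ (sym G z~a₂) (adj-2+ j)
        (proj₁ x⊥y) x≁a₂ (proj₁ x⊥z) (≁-sym G z≁a₀) (proj₁ y⊥z))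

      x~a₂ : Adj G x (a (2 + j))
      x~a₂ with adj? G x (a (2 + j))
      ... | yes x~a₂ = x~a₂
      ... | no x≁a₂  = ⊥-elim (no-bull (induced-bull G
        y~a₀ (sym G x~a₀) x~a₃ (sym G z~a₃) (adj-3+ j)
        (≁-sym G (proj₁ x⊥y)) y≁a₃ (proj₁ y⊥z) (≁-sym G z≁a₀) (proj₁ x⊥z)))
        where
        z~a₃ : Adj G z (a (3 + j))
        z~a₃ = covering-next z-covering z≁a₂
        x~a₃ : Adj G x (a (3 + j))
        x~a₃ = covering-next x-covering x≁a₂
        y≁a₃ : ¬ Adj G y (a (3 + j))
        y≁a₃ = λ y~a₃ → ¬common-neighbour x⊥y x⊥z y⊥z x~a₃ y~a₃ z~a₃

  phase-iterate : ∀ {x y z} → CoveringTriple x y z →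
                  ∀ d {t} → Phase x y z t → Phase x y z (twice d + t)
  phase-iterate T zero    φ = φ
  phase-iterate T (suc d) φ = phase-shift (swap T) (phase-shift T (phase-iterate T d φ))

  -- Each shift swaps the roles of y and z, which the odd period 2k + 1 does not allow.
  ¬phase : ∀ {x y z t} → CoveringTriple x y z → Phase x y z t → ⊥
  ¬phase {z = z} {t} T φ@(_ , _ , z≁aₜ , _ , _ , _) with phase-iterate T k φ
  ... | _ , _ , z≁aₛ , _ , _ , _ =
    z≁aₜ (subst (Adj G z) (period t) (covering-next (CoveringTriple.z-covering T) z≁aₛ))

  ¬independent-triple₀ : ∀ {x y z} → Covering x → Covering y → Covering z →
                         Independent G x y → Independent G x z → Independent G y z → ⊥
  ¬independent-triple₀ {x} {y} {z} cov-x cov-y cov-z x⊥y x⊥z y⊥z =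
    from-pair (covering⇒consecutive-neighbours cov-x)
    where
    T : CoveringTriple x y z
    T = record { x-covering = cov-x ; y-covering = cov-y ; z-covering = cov-z
               ; x⊥y = x⊥y ; x⊥z = x⊥z ; y⊥z = y⊥z }

    from-pair : ∃[ i ] Adj G x (a i) × Adj G x (a (suc i)) → ⊥
    from-pair (i , x~a₀ , x~a₁) with adj? G y (a i)
    ... | yes y~a₀ = ¬phase T (phase-start T x~a₀ x~a₁ y~a₀)
    ... | no y≁a₀  = ¬phase (swap T) (phase-start (swap T) x~a₀ x~a₁ z~a₀)
      where
      z~a₀ : Adj G z (a i)
      z~a₀ = covering-prev cov-z (¬common-neighbour x⊥y x⊥z y⊥z x~a₁ (covering-next cov-y y≁a₀))

  ¬independent-tame-triple : ∀ {x y z} → Tame x → Tame y → Tame z →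
                             Independent G x y → Independent G x z → Independent G y z → ⊥
  ¬independent-tame-triple (inj₁ (_ , refl)) (inj₁ (_ , refl)) (inj₁ (_ , refl)) =
    ¬independent-triple₃
  ¬independent-tame-triple (inj₁ (_ , refl)) (inj₁ (_ , refl)) (inj₂ cov-z) =
    ¬independent-triple₂ cov-z
  ¬independent-tame-triple (inj₁ (_ , refl)) (inj₂ cov-y) (inj₁ (_ , refl)) x⊥y x⊥z y⊥z =
    ¬independent-triple₂ cov-y x⊥z x⊥y (Independent-sym G y⊥z)
  ¬independent-tame-triple (inj₂ cov-x) (inj₁ (_ , refl)) (inj₁ (_ , refl)) x⊥y x⊥z y⊥z =
    ¬independent-triple₂ cov-x y⊥z (Independent-sym G x⊥y) (Independent-sym G x⊥z)
  ¬independent-tame-triple (inj₁ (_ , refl)) (inj₂ cov-y) (inj₂ cov-z) =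
    ¬independent-triple₁ cov-y cov-z
  ¬independent-tame-triple (inj₂ cov-x) (inj₁ (_ , refl)) (inj₂ cov-z) x⊥y x⊥z y⊥z =
    ¬independent-triple₁ cov-x cov-z (Independent-sym G x⊥y) y⊥z x⊥z
  ¬independent-tame-triple (inj₂ cov-x) (inj₂ cov-y) (inj₁ (_ , refl)) x⊥y x⊥z y⊥z =
    ¬independent-triple₁ cov-x cov-y (Independent-sym G x⊥z) (Independent-sym G y⊥z) x⊥y
  ¬independent-tame-triple (inj₂ cov-x) (inj₂ cov-y) (inj₂ cov-z) =
    ¬independent-triple₀ cov-x cov-y cov-z

corollary2p5 : {n : ℕ} (G : Graph n) → Connected G →
    ¬ HasInducedBull G → ¬ HasInducedClaw G →
    HasInducedOddAntihole G → IndependenceNumber G 2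
corollary2p5 G connected no-bull no-claw (_ , (k , refl) , 5≤m , _ , H-antihole , H≤G) =
  independenceNumber-2 G (consecutive-independent 0)
    (¬independent-tame-triple (tame _) (tame _) (tame _))
  where
  open ClawBullFree no-bull no-claw (cyclicOddAntihole {k = k} 5≤m H-antihole H≤G)
  tame : ∀ w → Tame w
  tame = connected⇒tame connected
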